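{- There exists $k_0$ such that for all integers $k\ge k_0$ and all positive integers $t\le\log k$, \[ \mathcal{SP}_{t,k}\le\exp\left(k\log k-\frac{k}{t}\log k-k\log t+3k\right). \]
   Context: $\mathcal{SP}_{t,k}$ denotes the number of set partitions of $[k]=\{1,\dots,k\}$ all of whose blocks have size at most $t$. Logarithms are natural. -}

module Defs where

open import Data.Nat using (ℕ; zero; suc; _+_; _*_; _∸_; _^_; _≤_; _<_; _≤ᵇ_)
open import Data.Bool using (Bool; true; false; _∧_; _∨_; not)
open import Data.Fin using (Fin)
open import Data.Vec using (Vec; []; _∷_; lookup)
open import Data.List using (List; []; _∷_; [_]; map; concatMap; filterᵇ; length; allFin)

vecs : {A : Set} → (n : ℕ) → List A → List (Vec A n)
vecs zero    xs = [ [] ]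
vecs (suc n) xs = concatMap (λ x → map (x ∷_) (vecs n xs)) xs

every : {A : Set} → (A → Bool) → List A → Bool
every p []       = true
every p (x ∷ xs) = p x ∧ every p xs

BRel : ℕ → Set
BRel k = Vec (Vec Bool k) k

rel : {k : ℕ} → BRel k → Fin k → Fin k → Bool
rel R i j = lookup (lookup R i) j

isEquivRel : {k : ℕ} → BRel k → Bool
isEquivRel {k} R =
  every (λ i → rel R i i) (allFin k) ∧
  every (λ i → every (λ j → not (rel R i j) ∨ rel R j i) (allFin k)) (allFin k) ∧
  every (λ i → every (λ j → every (λ l → not (rel R i j ∧ rel R j l) ∨ rel R i l)
                             (allFin k)) (allFin k)) (allFin k)

blocksAtMost : {k : ℕ} → ℕ → BRel k → Bool
blocksAtMost {k} t R =
  every (λ i → length (filterᵇ (rel R i) (allFin k)) ≤ᵇ t) (allFin k)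

-- SP t k : number of set partitions of [k] all of whose blocks have size ≤ t
-- (set partitions of [k] are identified with equivalence relations on [k])
SP : ℕ → ℕ → ℕ
SP t k = length (filterᵇ (λ R → isEquivRel R ∧ blocksAtMost t R)
                         (vecs k (vecs k (true ∷ false ∷ []))))

-- Real exponentials, encoded exactly via monotone rational sequences:
-- (1 + m/n)^n increases to e^m, and (n/(n-m))^n (n > m) decreases to e^m.

-- ExpLe m x  means  e^m ≤ x,  i.e.  m ≤ log x
ExpLe : ℕ → ℕ → Set
ExpLe m x = ∀ n → 1 ≤ n → (n + m) ^ n ≤ x * n ^ n

-- LeMulExp N M m  means  N ≤ M · e^m
LeMulExp : ℕ → ℕ → ℕ → Set
LeMulExp N M m = ∀ n → m < n → N * (n ∸ m) ^ n ≤ M * n ^ n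

-- A partition of [k] with blocks of size at most t is determined by the set S of its
-- block minima together with the map sending each of the other k - m elements
-- (m = |S|) to the minimum of its block; as blocks have at most t elements, k ≤ m t.  Hence
--   SP t k ≤ Σ_{S : k ≤ |S| t} m ^ (k - m) ≤ 2 ^ k · max_{k ≤ m t} m ^ (k - m).
-- For such m write m t = k + d.  Then m ^ ((k - m) t) · t ^ (k t) · m ^ (m t) = (m t) ^ (k t),
-- and (1 + d/k) ^ (k t) ≤ e ^ (d t) ≤ k ^ d because t ≤ log k, so
-- (m t) ^ (k t) ≤ k ^ (k t + d) = k ^ (k (t - 1)) · (k ^ m) ^ t; finally (k/m) ^ m ≤ 4 ^ k.
-- Altogether SP^t · t^(k t) ≤ k^(k (t - 1)) · 2^(k t) · 4^(k t) ≤ k^(k (t - 1)) · e^(3 k t)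
-- for every k, so k₀ = 0 works.
module Submission where

open import Defs
open import Algebra.Properties.CommutativeSemigroup
  using (xy∙z≈xz∙y; xy∙z≈x∙zy; x∙yz≈yx∙z; x∙yz≈y∙xz)
open import Data.Bool using (Bool; true; false; not; T; T?; _∧_; _∨_)
open import Data.Bool.Properties using (T-∧)
open import Data.Empty using (⊥-elim)
open import Data.Fin using (Fin; _≟_)
open import Data.List
  using (List; []; _∷_; map; filter; filterᵇ; length; allFin; _++_; concatMap; cartesianProductWith)
open import Data.List.Membership.Propositional using (_∈_)
open import Data.List.Membership.Propositional.Properties
  using (∈-allFin; ∈-map⁺; ∈-filter⁺; ∈-filter⁻; ∈-cartesianProductWith⁺; ∈-concat⁺′)
import Data.List.Properties as List
open import Data.List.Relation.Binary.Sublist.Propositional using (⊆-refl)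
import Data.List.Relation.Binary.Sublist.Propositional.Properties as Sublist
open import Data.List.Relation.Unary.All as All using (All; []; _∷_)
import Data.List.Relation.Unary.All.Properties as All
open import Data.List.Relation.Unary.Any using (here; there; _─_; index)
open import Data.List.Relation.Unary.Unique.Propositional using (Unique; []; _∷_)
import Data.List.Relation.Unary.Unique.Propositional.Properties as Unique
open import Data.Nat
  using (ℕ; zero; suc; _+_; _*_; _∸_; _^_; _≤_; _<_; _≤?_; _≤ᵇ_; z≤n; s≤s; NonZero; _/_; _%_;
         >-nonZero; >-nonZero⁻¹)
open import Data.Nat.DivMod using (m≡m%n+[m/n]*n; m%n<n; m/n*n≤m)
open import Data.Nat.ListAction using (sum)
open import Data.Nat.Properties hiding (_≟_)
open import Data.List.Extrema ≤-totalOrder using (max; xs≤max; argmax-all)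
open import Data.Nat.Tactic.RingSolver using (solve-∀)
open import Data.Product using (∃-syntax; _×_; _,_; proj₁; proj₂)
open import Data.Unit using (tt)
open import Data.Vec as Vec using (Vec; lookup; tabulate; toList)
import Data.Vec.Properties as Vec
import Data.Vec.Relation.Unary.All as VecAll
import Data.Vec.Relation.Unary.All.Properties as VecAll
open import Function using (_∘_; id; Equivalence)
open import Relation.Binary.Definitions using (DecidableEquality)
open import Relation.Binary.PropositionalEquality
open import Relation.Binary.Structures using (IsEquivalence)
open import Relation.Nullary using (no)
open import Relation.Nullary.Decidable using (isYes; toWitness; fromWitness)
open import Relation.Unary using (Decidable)

private variable
  A B : Set

-- Elementary inequalities between powers

^-distribʳ-* : ∀ m n o → (m * n) ^ o ≡ m ^ o * n ^ o
^-distribʳ-* m n zero    = refl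
^-distribʳ-* m n (suc o) = begin
  m * n * (m * n) ^ o      ≡⟨ cong (m * n *_) (^-distribʳ-* m n o) ⟩
  m * n * (m ^ o * n ^ o)  ≡⟨ [m*n]*[o*p]≡[m*o]*[n*p] m n (m ^ o) (n ^ o) ⟩
  m * m ^ o * (n * n ^ o)  ∎
  where open ≡-Reasoning

[m^n]^o≡[m^o]^n : ∀ m n o → (m ^ n) ^ o ≡ (m ^ o) ^ n
[m^n]^o≡[m^o]^n m n o = begin
  (m ^ n) ^ o  ≡⟨ ^-*-assoc m n o ⟩
  m ^ (n * o)  ≡⟨ cong (m ^_) (*-comm n o) ⟩
  m ^ (o * n)  ≡⟨ ^-*-assoc m o n ⟨
  (m ^ o) ^ n  ∎
  where open ≡-Reasoning

n<2^n : ∀ n → n < 2 ^ n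
n<2^n zero    = s≤s z≤n
n<2^n (suc n) = begin-strict
  suc n          <⟨ s≤s (n<2^n n) ⟩
  suc (2 ^ n)    ≡⟨ +-comm 1 (2 ^ n) ⟩
  2 ^ n + 1      ≤⟨ +-monoʳ-≤ (2 ^ n) (m^n>0 2 n) ⟩
  2 ^ n + 2 ^ n  ≡⟨ cong (2 ^ n +_) (+-identityʳ (2 ^ n)) ⟨
  2 ^ suc n      ∎
  where open ≤-Reasoning

bernoulli : ∀ b d → (b + d) * b ^ d ≤ b * suc b ^ d
bernoulli b zero    = ≤-reflexive (cong (_* 1) (+-identityʳ b))
bernoulli b (suc d) = begin
  (b + suc d) * (b * b ^ d)            ≡⟨ expand b d (b ^ d) ⟩
  b * ((b + d) * b ^ d) + b * b ^ d    ≤⟨ +-mono-≤ (*-monoʳ-≤ b (bernoulli b d))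
                                                   (*-monoʳ-≤ b (^-monoˡ-≤ d (n≤1+n b))) ⟩
  b * (b * suc b ^ d) + b * suc b ^ d  ≡⟨ collect b (suc b ^ d) ⟩
  b * (suc b * suc b ^ d)              ∎
  where
  open ≤-Reasoning
  expand : ∀ b d x → (b + suc d) * (b * x) ≡ b * ((b + d) * x) + b * x
  expand = solve-∀
  collect : ∀ b y → b * (b * y) + b * y ≡ b * (suc b * y)
  collect = solve-∀

2*m^n≤[1+m]^n : ∀ {m n} → m < n → 2 * m ^ n ≤ suc m ^ n
2*m^n≤[1+m]^n {zero}  {suc n} _   = z≤n
2*m^n≤[1+m]^n {suc m} {n}     m<n = *-cancelˡ-≤ (suc m) (begin
  suc m * (2 * suc m ^ n)      ≡⟨ double (suc m) (suc m ^ n) ⟩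
  (suc m + suc m) * suc m ^ n  ≤⟨ *-monoˡ-≤ (suc m ^ n) (+-monoʳ-≤ (suc m) (<⇒≤ m<n)) ⟩
  (suc m + n) * suc m ^ n      ≤⟨ bernoulli (suc m) n ⟩
  suc m * suc (suc m) ^ n      ∎)
  where
  open ≤-Reasoning
  double : ∀ a y → a * (2 * y) ≡ (a + a) * y
  double = solve-∀

-- The discrete form of 2 ^ a ≤ e ^ a: (1 - a/n) ^ n · 2 ^ a ≤ 1.
[n∸a]^n*2^a≤n^n : ∀ {a n} → a ≤ n → (n ∸ a) ^ n * 2 ^ a ≤ n ^ n
[n∸a]^n*2^a≤n^n {a} {n} a≤n =
  subst (λ e → (n ∸ a) ^ e * 2 ^ a ≤ e ^ e) (m+[n∸m]≡n a≤n) (shifted a (n ∸ a))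
  where
  open ≤-Reasoning
  shifted : ∀ a m → m ^ (a + m) * 2 ^ a ≤ (a + m) ^ (a + m)
  shifted zero    m = ≤-reflexive (*-identityʳ _)
  shifted (suc a) m = begin
    m ^ (suc a + m) * (2 * 2 ^ a)  ≡⟨ x∙yz≈yx∙z *-commutativeSemigroup (m ^ (suc a + m)) 2 (2 ^ a) ⟩
    2 * m ^ (suc a + m) * 2 ^ a    ≤⟨ *-monoˡ-≤ (2 ^ a) (2*m^n≤[1+m]^n (s≤s (m≤n+m m a))) ⟩
    suc m ^ (suc a + m) * 2 ^ a    ≡⟨ cong (λ e → suc m ^ e * 2 ^ a) (+-suc a m) ⟨
    suc m ^ (a + suc m) * 2 ^ a    ≤⟨ shifted a (suc m) ⟩
    (a + suc m) ^ (a + suc m)      ≡⟨ cong (λ e → e ^ e) (+-suc a m) ⟩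
    (suc a + m) ^ (suc a + m)      ∎

n^m≤4^n*m^m : ∀ n m .{{_ : NonZero m}} → m ≤ n → n ^ m ≤ 4 ^ n * m ^ m
n^m≤4^n*m^m n m m≤n = begin
  n ^ m                ≤⟨ ^-monoˡ-≤ m n≤qm ⟩
  (q * m) ^ m          ≡⟨ ^-distribʳ-* q m m ⟩
  q ^ m * m ^ m        ≤⟨ *-monoˡ-≤ (m ^ m) (^-monoˡ-≤ m (<⇒≤ (n<2^n q))) ⟩
  (2 ^ q) ^ m * m ^ m  ≡⟨ cong (_* m ^ m) (^-*-assoc 2 q m) ⟩
  2 ^ (q * m) * m ^ m  ≤⟨ *-monoˡ-≤ (m ^ m) (^-monoʳ-≤ 2 qm≤2n) ⟩
  2 ^ (2 * n) * m ^ m  ≡⟨ cong (_* m ^ m) (^-*-assoc 2 2 n) ⟨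
  4 ^ n * m ^ m        ∎
  where
  open ≤-Reasoning
  q : ℕ
  q = suc (n / m)
  n≤qm : n ≤ q * m
  n≤qm = begin
    n                  ≡⟨ m≡m%n+[m/n]*n n m ⟩
    n % m + n / m * m  ≤⟨ +-monoˡ-≤ (n / m * m) (<⇒≤ (m%n<n n m)) ⟩
    q * m              ∎
  qm≤2n : q * m ≤ 2 * n
  qm≤2n = begin
    m + n / m * m  ≤⟨ +-mono-≤ m≤n (m/n*n≤m n m) ⟩
    n + n          ≡⟨ cong (n +_) (+-identityʳ n) ⟨
    2 * n          ∎

[2^k]^t*[4^k]^t≡2^[3kt] : ∀ k t → (2 ^ k) ^ t * (4 ^ k) ^ t ≡ 2 ^ (3 * k * t)
[2^k]^t*[4^k]^t≡2^[3kt] k t = begin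
  (2 ^ k) ^ t * (4 ^ k) ^ t  ≡⟨ ^-distribʳ-* (2 ^ k) (4 ^ k) t ⟨
  (2 ^ k * 4 ^ k) ^ t        ≡⟨ cong (λ x → (2 ^ k * x) ^ t) (^-*-assoc 2 2 k) ⟩
  (2 ^ k * 2 ^ (2 * k)) ^ t  ≡⟨ cong (_^ t) (^-distribˡ-+-* 2 k (2 * k)) ⟨
  (2 ^ (k + 2 * k)) ^ t      ≡⟨ cong (λ e → (2 ^ e) ^ t) (k+2k≡3k k) ⟩
  (2 ^ (3 * k)) ^ t          ≡⟨ ^-*-assoc 2 (3 * k) t ⟩
  2 ^ (3 * k * t)            ∎
  where
  open ≡-Reasoning
  k+2k≡3k : ∀ k → k + 2 * k ≡ 3 * k
  k+2k≡3k = solve-∀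

-- Consequences of e ^ m ≤ x

ExpLe⇒< : ∀ {m x} → ExpLe m x → m < x
ExpLe⇒< {m} {x} e^m≤x = *-cancelʳ-≤ (suc m) x 1 (e^m≤x 1 ≤-refl)

-- (1 + 1/b) ^ (b m) ≤ e ^ m ≤ x
ExpLe⇒[1+b]^bm≤x*b^bm : ∀ {m x} → ExpLe m x → ∀ b .{{_ : NonZero b}} .{{_ : NonZero m}} →
                        suc b ^ (b * m) ≤ x * b ^ (b * m)
ExpLe⇒[1+b]^bm≤x*b^bm {m} {x} e^m≤x b = *-cancelʳ-≤ _ _ (m ^ n) {{m^n≢0 m n}} (begin
  suc b ^ n * m ^ n    ≡⟨ ^-distribʳ-* (suc b) m n ⟨
  (suc b * m) ^ n      ≡⟨ cong (_^ n) (+-comm m n) ⟩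
  (n + m) ^ n          ≤⟨ e^m≤x n (>-nonZero⁻¹ n {{m*n≢0 b m}}) ⟩
  x * n ^ n            ≡⟨ cong (x *_) (^-distribʳ-* b m n) ⟩
  x * (b ^ n * m ^ n)  ≡⟨ *-assoc x (b ^ n) (m ^ n) ⟨
  x * b ^ n * m ^ n    ∎)
  where
  open ≤-Reasoning
  n : ℕ
  n = b * m

-- (1 + d/b) ^ (b m) ≤ (1 + 1/b) ^ (b m d) ≤ x ^ d
ExpLe⇒[b+d]^bm≤b^bm*x^d : ∀ {m x} → ExpLe m x → ∀ b d .{{_ : NonZero b}} .{{_ : NonZero m}} →
                          (b + d) ^ (b * m) ≤ b ^ (b * m) * x ^ d
ExpLe⇒[b+d]^bm≤b^bm*x^d {m} {x} e^m≤x b d =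
  *-cancelʳ-≤ _ _ ((b ^ n) ^ d) {{m^n≢0 (b ^ n) d {{m^n≢0 b n}}}} (begin
    (b + d) ^ n * (b ^ n) ^ d      ≡⟨ cong ((b + d) ^ n *_) ([m^n]^o≡[m^o]^n b n d) ⟩
    (b + d) ^ n * (b ^ d) ^ n      ≡⟨ ^-distribʳ-* (b + d) (b ^ d) n ⟨
    ((b + d) * b ^ d) ^ n          ≤⟨ ^-monoˡ-≤ n (bernoulli b d) ⟩
    (b * suc b ^ d) ^ n            ≡⟨ ^-distribʳ-* b (suc b ^ d) n ⟩
    b ^ n * (suc b ^ d) ^ n        ≡⟨ cong (b ^ n *_) ([m^n]^o≡[m^o]^n (suc b) d n) ⟩
    b ^ n * (suc b ^ n) ^ d        ≤⟨ *-monoʳ-≤ (b ^ n)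
                                        (^-monoˡ-≤ d (ExpLe⇒[1+b]^bm≤x*b^bm {m} {x} e^m≤x b)) ⟩
    b ^ n * (x * b ^ n) ^ d        ≡⟨ cong (b ^ n *_) (^-distribʳ-* x (b ^ n) d) ⟩
    b ^ n * (x ^ d * (b ^ n) ^ d)  ≡⟨ *-assoc (b ^ n) (x ^ d) ((b ^ n) ^ d) ⟨
    b ^ n * x ^ d * (b ^ n) ^ d    ∎)
  where
  open ≤-Reasoning
  n : ℕ
  n = b * m

[mt]^kt≤k^[k[t∸1]]*[k^m]^t : ∀ {k m t} .{{_ : NonZero m}} .{{_ : NonZero t}} → ExpLe t k → k ≤ m * t →
                             (m * t) ^ (k * t) ≤ k ^ (k * (t ∸ 1)) * (k ^ m) ^ t
[mt]^kt≤k^[k[t∸1]]*[k^m]^t {k} {m} {t@(suc t-1)} e^t≤k k≤mt = begin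
  (m * t) ^ (k * t)            ≡⟨ cong (_^ (k * t)) (m+[n∸m]≡n k≤mt) ⟨
  (k + d) ^ (k * t)            ≤⟨ ExpLe⇒[b+d]^bm≤b^bm*x^d e^t≤k k d ⟩
  k ^ (k * t) * k ^ d          ≡⟨ ^-distribˡ-+-* k (k * t) d ⟨
  k ^ (k * t + d)              ≡⟨ cong (k ^_) exponents ⟩
  k ^ (k * t-1 + m * t)        ≡⟨ ^-distribˡ-+-* k (k * t-1) (m * t) ⟩
  k ^ (k * t-1) * k ^ (m * t)  ≡⟨ cong (k ^ (k * t-1) *_) (^-*-assoc k m t) ⟨
  k ^ (k * t-1) * (k ^ m) ^ t  ∎
  where
  open ≤-Reasoning
  d : ℕ
  d = m * t ∸ k
  instance
    k≢0 : NonZero k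
    k≢0 = >-nonZero (≤-<-trans z≤n (ExpLe⇒< e^t≤k))
  exponents : k * t + d ≡ k * t-1 + m * t
  exponents = begin-equality
    k * t + d          ≡⟨ cong (_+ d) (*-suc k t-1) ⟩
    k + k * t-1 + d    ≡⟨ cong (_+ d) (+-comm k (k * t-1)) ⟩
    k * t-1 + k + d    ≡⟨ +-assoc (k * t-1) k d ⟩
    k * t-1 + (k + d)  ≡⟨ cong (k * t-1 +_) (m+[n∸m]≡n k≤mt) ⟩
    k * t-1 + m * t    ∎

[m^n]^t*t^kt≤k^[k[t∸1]]*[4^k]^t : ∀ {k m n t} .{{_ : NonZero t}} →
                                 ExpLe t k → m + n ≡ k → k ≤ m * t →
                                 (m ^ n) ^ t * t ^ (k * t) ≤ k ^ (k * (t ∸ 1)) * (4 ^ k) ^ t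
[m^n]^t*t^kt≤k^[k[t∸1]]*[4^k]^t {k} {m} {n} {t} e^t≤k m+n≡k k≤mt =
  *-cancelʳ-≤ _ _ ((m ^ m) ^ t) {{m^n≢0 (m ^ m) t {{m^n≢0 m m}}}} (begin
    (m ^ n) ^ t * t ^ (k * t) * (m ^ m) ^ t  ≡⟨ collect ⟩
    (m * t) ^ (k * t)                        ≤⟨ [mt]^kt≤k^[k[t∸1]]*[k^m]^t {k} {m} e^t≤k k≤mt ⟩
    K * (k ^ m) ^ t                          ≤⟨ *-monoʳ-≤ K (^-monoˡ-≤ t (n^m≤4^n*m^m k m m≤k)) ⟩
    K * (4 ^ k * m ^ m) ^ t                  ≡⟨ cong (K *_) (^-distribʳ-* (4 ^ k) (m ^ m) t) ⟩
    K * ((4 ^ k) ^ t * (m ^ m) ^ t)          ≡⟨ *-assoc K ((4 ^ k) ^ t) ((m ^ m) ^ t) ⟨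
    K * (4 ^ k) ^ t * (m ^ m) ^ t            ∎)
  where
  open ≤-Reasoning
  K : ℕ
  K = k ^ (k * (t ∸ 1))
  instance
    m≢0 : NonZero m
    m≢0 = m*n≢0⇒m≢0 m {{>-nonZero (<-≤-trans (≤-<-trans z≤n (ExpLe⇒< e^t≤k)) k≤mt)}}
  n+m≡k : n + m ≡ k
  n+m≡k = trans (+-comm n m) m+n≡k
  m≤k : m ≤ k
  m≤k = subst (m ≤_) m+n≡k (m≤m+n m n)
  collect : (m ^ n) ^ t * t ^ (k * t) * (m ^ m) ^ t ≡ (m * t) ^ (k * t)
  collect = begin-equality
    (m ^ n) ^ t * t ^ (k * t) * (m ^ m) ^ t  ≡⟨ xy∙z≈xz∙y *-commutativeSemigroup ((m ^ n) ^ t) _ _ ⟩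
    (m ^ n) ^ t * (m ^ m) ^ t * t ^ (k * t)  ≡⟨ cong (_* t ^ (k * t)) (^-distribʳ-* (m ^ n) (m ^ m) t) ⟨
    (m ^ n * m ^ m) ^ t * t ^ (k * t)        ≡⟨ cong (λ x → x ^ t * t ^ (k * t)) (^-distribˡ-+-* m n m) ⟨
    (m ^ (n + m)) ^ t * t ^ (k * t)          ≡⟨ cong (λ e → (m ^ e) ^ t * t ^ (k * t)) n+m≡k ⟩
    (m ^ k) ^ t * t ^ (k * t)                ≡⟨ cong (_* t ^ (k * t)) (^-*-assoc m k t) ⟩
    m ^ (k * t) * t ^ (k * t)                ≡⟨ ^-distribʳ-* m t (k * t) ⟨
    (m * t) ^ (k * t)                        ∎

N≤M*2^a⇒LeMulExp : ∀ {N} M a → N ≤ M * 2 ^ a → LeMulExp N M a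
N≤M*2^a⇒LeMulExp {N} M a N≤M*2^a n a<n = begin
  N * (n ∸ a) ^ n            ≤⟨ *-monoˡ-≤ ((n ∸ a) ^ n) N≤M*2^a ⟩
  M * 2 ^ a * (n ∸ a) ^ n    ≡⟨ xy∙z≈x∙zy *-commutativeSemigroup M (2 ^ a) ((n ∸ a) ^ n) ⟩
  M * ((n ∸ a) ^ n * 2 ^ a)  ≤⟨ *-monoʳ-≤ M ([n∸a]^n*2^a≤n^n (<⇒≤ a<n)) ⟩
  M * n ^ n                  ∎
  where open ≤-Reasoning

sum≤length*v : ∀ {v} ws → All (_≤ v) ws → sum ws ≤ length ws * v
sum≤length*v []       []           = z≤n
sum≤length*v (w ∷ ws) (w≤v ∷ ws≤v) = +-mono-≤ w≤v (sum≤length*v ws ws≤v)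

[sum]^t*y≤[length]^t*z : ∀ t .{{_ : NonZero t}} {y z} ws → All (λ w → w ^ t * y ≤ z) ws →
                         sum ws ^ t * y ≤ length ws ^ t * z
[sum]^t*y≤[length]^t*z t@(suc _) {y} {z} ws bounded = begin
  sum ws ^ t * y               ≤⟨ *-monoˡ-≤ y (^-monoˡ-≤ t (sum≤length*v ws (xs≤max 0 ws))) ⟩
  (length ws * v) ^ t * y      ≡⟨ cong (_* y) (^-distribʳ-* (length ws) v t) ⟩
  length ws ^ t * v ^ t * y    ≡⟨ *-assoc (length ws ^ t) (v ^ t) y ⟩
  length ws ^ t * (v ^ t * y)  ≤⟨ *-monoʳ-≤ (length ws ^ t) (argmax-all id z≤n bounded) ⟩
  length ws ^ t * z            ∎
  where
  open ≤-Reasoning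
  v : ℕ
  v = max 0 ws

-- Counting lists

length-filterᵇ+length-filterᵇ-not : ∀ (p : A → Bool) xs →
  length (filterᵇ p xs) + length (filterᵇ (not ∘ p) xs) ≡ length xs
length-filterᵇ+length-filterᵇ-not p []       = refl
length-filterᵇ+length-filterᵇ-not p (x ∷ xs) with p x
... | true  = cong suc (length-filterᵇ+length-filterᵇ-not p xs)
... | false = trans (+-suc _ _) (cong suc (length-filterᵇ+length-filterᵇ-not p xs))

length-filterᵇ-mono : ∀ {p q : A → Bool} → (∀ {x} → T (p x) → T (q x)) → ∀ xs →
                      length (filterᵇ p xs) ≤ length (filterᵇ q xs)
length-filterᵇ-mono {p = p} {q} p⇒q xs =
  Sublist.length-mono-≤ (Sublist.filter⁺ (T? ∘ p) (T? ∘ q) (λ { refl → p⇒q }) (⊆-refl {x = xs}))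

length-filterᵇ∘filterᵇ≤ : ∀ (p q : A → Bool) xs →
                          length (filterᵇ p (filterᵇ q xs)) ≤ length (filterᵇ p xs)
length-filterᵇ∘filterᵇ≤ p q xs = Sublist.length-mono-≤
  (Sublist.filter⁺ (T? ∘ p) (T? ∘ p) (λ { refl → id }) (Sublist.filter-⊆ (T? ∘ q) xs))

module _ (_≟_ : DecidableEquality B) (g : A → B) where

  fibre : B → List A → List A
  fibre y = filterᵇ (λ x → isYes (g x ≟ y))

  pigeonhole : ∀ {t} ys xs → All (λ x → g x ∈ ys) xs → (∀ y → length (fibre y xs) ≤ t) →
               length xs ≤ length ys * t
  pigeonhole []       []       _        _ = z≤n
  pigeonhole []       (x ∷ xs) (() ∷ _) _
  pigeonhole {t} (y ∷ ys) xs g[xs]⊆y∷ys fibres≤t = begin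
    length xs                          ≡⟨ length-filterᵇ+length-filterᵇ-not g⁻¹y xs ⟨
    length (fibre y xs) + length rest  ≤⟨ +-mono-≤ (fibres≤t y)
                                                   (pigeonhole ys rest g[rest]⊆ys fibres-rest≤t) ⟩
    t + length ys * t                  ∎
    where
    open ≤-Reasoning
    g⁻¹y : A → Bool
    g⁻¹y x = isYes (g x ≟ y)
    rest : List A
    rest = filterᵇ (not ∘ g⁻¹y) xs
    other : ∀ {x} → g x ∈ y ∷ ys → T (not (g⁻¹y x)) → g x ∈ ys
    other         (there g[x]∈ys) _ = g[x]∈ys
    other {x = x} (here g[x]≡y)   _ with g x ≟ y
    ... | no g[x]≢y = ⊥-elim (g[x]≢y g[x]≡y)
    g[rest]⊆ys : All (λ x → g x ∈ ys) rest
    g[rest]⊆ys = All.zipWith (λ (m , ne) → other m ne)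
      (All.filter⁺ (T? ∘ not ∘ g⁻¹y) g[xs]⊆y∷ys , All.all-filter (T? ∘ not ∘ g⁻¹y) xs)
    fibres-rest≤t : ∀ y′ → length (fibre y′ rest) ≤ t
    fibres-rest≤t y′ = ≤-trans (length-filterᵇ∘filterᵇ≤ _ _ xs) (fibres≤t y′)

∈-─ : ∀ {x y : A} {ys} (y∈ys : y ∈ ys) → x ∈ ys → x ≢ y → x ∈ (ys ─ y∈ys)
∈-─ (here refl)  (here refl)  x≢y = ⊥-elim (x≢y refl)
∈-─ (here _)     (there x∈ys) _   = x∈ys
∈-─ (there _)    (here x≡y′)  _   = here x≡y′
∈-─ (there y∈ys) (there x∈ys) x≢y = there (∈-─ y∈ys x∈ys x≢y)

injection⇒length≤ : ∀ (f : A → B) {xs ys} → Unique xs → (∀ {x} → x ∈ xs → f x ∈ ys) →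
                    (∀ {x x′} → x ∈ xs → x′ ∈ xs → f x ≡ f x′ → x ≡ x′) → length xs ≤ length ys
injection⇒length≤ f {[]}     _               _        _         = z≤n
injection⇒length≤ f {x ∷ xs} {ys} (x∉xs ∷ unique) f[xs]⊆ys injective = begin
  suc (length xs)            ≤⟨ s≤s (injection⇒length≤ f unique f[xs]⊆ys─fx
                                       (λ p q → injective (there p) (there q))) ⟩
  suc (length (ys ─ fx∈ys))  ≡⟨ List.length-removeAt′ ys (index fx∈ys) ⟨
  length ys                  ∎
  where
  open ≤-Reasoning
  fx∈ys : f x ∈ ys
  fx∈ys = f[xs]⊆ys (here refl)
  f[xs]⊆ys─fx : ∀ {x′} → x′ ∈ xs → f x′ ∈ (ys ─ fx∈ys)
  f[xs]⊆ys─fx x′∈xs = ∈-─ fx∈ys (f[xs]⊆ys (there x′∈xs))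
    (λ fx′≡fx → All.lookup x∉xs x′∈xs (injective (here refl) (there x′∈xs) (sym fx′≡fx)))

map-≡⇒pointwise : ∀ {f g : A → B} {xs x} → map f xs ≡ map g xs → x ∈ xs → f x ≡ g x
map-≡⇒pointwise {xs = _ ∷ _} fxs≡gxs (here refl)  = List.∷-injectiveˡ fxs≡gxs
map-≡⇒pointwise {xs = _ ∷ _} fxs≡gxs (there x∈xs) =
  map-≡⇒pointwise (List.∷-injectiveʳ fxs≡gxs) x∈xs

length-concatMap : ∀ (f : A → List B) xs → length (concatMap f xs) ≡ sum (map (length ∘ f) xs)
length-concatMap f []       = refl
length-concatMap f (x ∷ xs) = trans (List.length-++ (f x)) (cong (length (f x) +_) (length-concatMap f xs))

∈-concatMap⁺ : ∀ {f : A → List B} {x xs y} → y ∈ f x → x ∈ xs → y ∈ concatMap f xs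
∈-concatMap⁺ {f = f} y∈fx x∈xs = ∈-concat⁺′ y∈fx (∈-map⁺ f x∈xs)

module _ {C : Set} (f : A → B → C) where

  concatMap-map≡cartesianProductWith : ∀ xs ys →
    concatMap (λ x → map (f x) ys) xs ≡ cartesianProductWith f xs ys
  concatMap-map≡cartesianProductWith []       ys = refl
  concatMap-map≡cartesianProductWith (x ∷ xs) ys =
    cong (map (f x) ys ++_) (concatMap-map≡cartesianProductWith xs ys)

  length-cartesianProductWith : ∀ xs ys → length (cartesianProductWith f xs ys) ≡ length xs * length ys
  length-cartesianProductWith []       ys = refl
  length-cartesianProductWith (x ∷ xs) ys = begin
    length (map (f x) ys ++ cartesianProductWith f xs ys)          ≡⟨ List.length-++ (map (f x) ys) ⟩
    length (map (f x) ys) + length (cartesianProductWith f xs ys)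
      ≡⟨ cong₂ _+_ (List.length-map (f x) ys) (length-cartesianProductWith xs ys) ⟩
    length ys + length xs * length ys                              ∎
    where open ≡-Reasoning

lookup-ext : ∀ {n} {u v : Vec A n} → (∀ i → lookup u i ≡ lookup v i) → u ≡ v
lookup-ext {u = u} {v} u≗v =
  trans (sym (Vec.tabulate∘lookup u)) (trans (Vec.tabulate-cong u≗v) (Vec.tabulate∘lookup v))

vecs-suc : ∀ n (xs : List A) → vecs (suc n) xs ≡ cartesianProductWith Vec._∷_ xs (vecs n xs)
vecs-suc n xs = concatMap-map≡cartesianProductWith Vec._∷_ xs (vecs n xs)

∈-vecs : ∀ {n} {xs : List A} {v : Vec A n} → VecAll.All (_∈ xs) v → v ∈ vecs n xs
∈-vecs                       VecAll.[]          = here refl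
∈-vecs {n = suc n} {xs = xs} (x∈xs VecAll.∷ v⊆xs) =
  subst (_ ∈_) (sym (vecs-suc n xs)) (∈-cartesianProductWith⁺ Vec._∷_ x∈xs (∈-vecs v⊆xs))

length-vecs : ∀ n (xs : List A) → length (vecs n xs) ≡ length xs ^ n
length-vecs zero    xs = refl
length-vecs (suc n) xs = begin
  length (vecs (suc n) xs)                              ≡⟨ cong length (vecs-suc n xs) ⟩
  length (cartesianProductWith Vec._∷_ xs (vecs n xs))
    ≡⟨ length-cartesianProductWith Vec._∷_ xs (vecs n xs) ⟩
  length xs * length (vecs n xs)                        ≡⟨ cong (length xs *_) (length-vecs n xs) ⟩
  length xs * length xs ^ n                             ∎
  where open ≡-Reasoning

vecs-unique : ∀ n {xs : List A} → Unique xs → Unique (vecs n xs)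
vecs-unique zero    _         = [] ∷ []
vecs-unique (suc n) {xs} uniq = subst Unique (sym (vecs-suc n xs))
  (Unique.cartesianProductWith⁺ Vec._∷_ Vec.∷-injective uniq (vecs-unique n uniq))

words : ℕ → List A → List (List A)
words n xs = map toList (vecs n xs)

length-words : ∀ n (xs : List A) → length (words n xs) ≡ length xs ^ n
length-words n xs = trans (List.length-map toList (vecs n xs)) (length-vecs n xs)

∈-words : ∀ {xs : List A} {u} → All (_∈ xs) u → u ∈ words (length u) xs
∈-words {xs = xs} {u} u⊆xs = subst (_∈ words (length u) xs) (Vec.toList∘fromList u)
  (∈-map⁺ toList (∈-vecs (VecAll.fromList⁺ u⊆xs)))

bools : List Bool
bools = true ∷ false ∷ []

bool∈bools : ∀ b → b ∈ bools
bool∈bools true  = here refl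
bool∈bools false = there (here refl)

bools-unique : Unique bools
bools-unique = ((λ ()) ∷ []) ∷ [] ∷ []

-- Partitions encoded by their block minima

every⇒All : ∀ {p : A → Bool} xs → T (every p xs) → All (T ∘ p) xs
every⇒All []       _          = []
every⇒All (x ∷ xs) p[x∷xs] with px , pxs ← Equivalence.to T-∧ p[x∷xs] = px ∷ every⇒All xs pxs

T-not-∨⇒ : ∀ {a b} → T (not a ∨ b) → T a → T b
T-not-∨⇒ {true} b _ = b

T-ext : ∀ {a b} → (T a → T b) → (T b → T a) → a ≡ b
T-ext {false} {false} _   _   = refl
T-ext {false} {true}  _   b⇒a = ⊥-elim (b⇒a tt)
T-ext {true}  {false} a⇒b _   = ⊥-elim (a⇒b tt)
T-ext {true}  {true}  _   _   = refl

headOr : A → List A → A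
headOr d []      = d
headOr _ (x ∷ _) = x

headOr∈ : ∀ {x : A} {xs} d → x ∈ xs → headOr d xs ∈ xs
headOr∈ {xs = _ ∷ _} _ _ = here refl

headOr-irrelevant : ∀ {x : A} {xs} d d′ → x ∈ xs → headOr d xs ≡ headOr d′ xs
headOr-irrelevant {xs = _ ∷ _} _ _ _ = refl

module _ {k : ℕ} where

  every-allFin⇒∀ : (p : Fin k → Bool) → T (every p (allFin k)) → ∀ i → T (p i)
  every-allFin⇒∀ p every-p i = All.lookup (every⇒All _ every-p) (∈-allFin i)

  every-allFin²⇒∀ : (p : Fin k → Fin k → Bool) →
                    T (every (λ i → every (p i) (allFin k)) (allFin k)) → ∀ i j → T (p i j)
  every-allFin²⇒∀ p every-p i = every-allFin⇒∀ (p i) (every-allFin⇒∀ _ every-p i)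

  every-allFin³⇒∀ : (p : Fin k → Fin k → Fin k → Bool) →
                    T (every (λ i → every (λ j → every (p i j) (allFin k)) (allFin k)) (allFin k)) →
                    ∀ i j l → T (p i j l)
  every-allFin³⇒∀ p every-p i = every-allFin²⇒∀ (p i) (every-allFin⇒∀ _ every-p i)

  Related : BRel k → Fin k → Fin k → Set
  Related R i j = T (rel R i j)

  isEquivRel⇒IsEquivalence : ∀ R → T (isEquivRel R) → IsEquivalence (Related R)
  isEquivRel⇒IsEquivalence R equiv
    with reflexive , symmetric∧transitive ← Equivalence.to (T-∧ {every _ (allFin k)}) equiv
    with symmetric , transitive ← Equivalence.to (T-∧ {every _ (allFin k)}) symmetric∧transitive = record
    { refl  = every-allFin⇒∀ (λ i → rel R i i) reflexive _
    ; sym   = λ {i} {j} →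
        T-not-∨⇒ (every-allFin²⇒∀ (λ i j → not (rel R i j) ∨ rel R j i) symmetric i j)
    ; trans = λ {i} {j} {l} Rij Rjl →
        T-not-∨⇒ (every-allFin³⇒∀ (λ i j l → not (rel R i j ∧ rel R j l) ∨ rel R i l) transitive i j l)
                 (Equivalence.from (T-∧ {rel R i j}) (Rij , Rjl))
    }

  block : BRel k → Fin k → List (Fin k)
  block R i = filterᵇ (rel R i) (allFin k)

  -- the least element of the block of i; the default i is never returned, as i ∈ block R i
  rep : BRel k → Fin k → Fin k
  rep R i = headOr i (block R i)

  isRep : BRel k → Fin k → Bool
  isRep R i = isYes (rep R i ≟ i)

  isRep⇒fixed : ∀ {R i} → T (isRep R i) → rep R i ≡ i
  isRep⇒fixed {R} {i} = toWitness {a? = rep R i ≟ i}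

  fixed⇒isRep : ∀ {R i} → rep R i ≡ i → T (isRep R i)
  fixed⇒isRep {R} {i} = fromWitness {a? = rep R i ≟ i}

  representatives : BRel k → Vec Bool k
  representatives R = tabulate (isRep R)

  members : Vec Bool k → List (Fin k)
  members b = filterᵇ (lookup b) (allFin k)

  nonMembers : Vec Bool k → List (Fin k)
  nonMembers b = filterᵇ (not ∘ lookup b) (allFin k)

  length-members+length-nonMembers : ∀ b → length (members b) + length (nonMembers b) ≡ k
  length-members+length-nonMembers b =
    trans (length-filterᵇ+length-filterᵇ-not (lookup b) (allFin k)) (List.length-tabulate id)

  code : BRel k → Vec Bool k × List (Fin k)
  code R = representatives R , map (rep R) (nonMembers (representatives R))

  module Representatives (R : BRel k) (equiv : IsEquivalence (Related R)) where
    open IsEquivalence equiv using () renaming (refl to ∼-refl; sym to ∼-sym; trans to ∼-trans)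

    ∈-block : ∀ {i j} → Related R i j → j ∈ block R i
    ∈-block = ∈-filter⁺ (T? ∘ rel R _) (∈-allFin _)

    block-cong : ∀ {i j} → Related R i j → block R i ≡ block R j
    block-cong Rij =
      List.filter-≐ (T? ∘ rel R _) (T? ∘ rel R _) (∼-trans (∼-sym Rij) , ∼-trans Rij) (allFin k)

    rep-related : ∀ i → Related R i (rep R i)
    rep-related i = proj₂ (∈-filter⁻ (T? ∘ rel R i) {xs = allFin k} (headOr∈ i (∈-block ∼-refl)))

    rep-cong : ∀ {i j} → Related R i j → rep R i ≡ rep R j
    rep-cong {i} {j} Rij = trans (cong (headOr i) (block-cong Rij)) (headOr-irrelevant i j (∈-block ∼-refl))

    rep-≡⇒related : ∀ {i j} → rep R i ≡ rep R j → Related R i j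
    rep-≡⇒related {i} {j} rep-i≡rep-j =
      ∼-trans (rep-related i) (subst (λ r → Related R r j) (sym rep-i≡rep-j) (∼-sym (rep-related j)))

    rep-idempotent : ∀ i → rep R (rep R i) ≡ rep R i
    rep-idempotent i = sym (rep-cong (rep-related i))

    rep∈representatives : ∀ i → rep R i ∈ members (representatives R)
    rep∈representatives i = ∈-filter⁺ (T? ∘ lookup (representatives R)) (∈-allFin (rep R i))
      (subst T (sym (Vec.lookup∘tabulate (isRep R) (rep R i))) (fixed⇒isRep {R} (rep-idempotent i)))

    k≤#representatives*t : ∀ {t} → T (blocksAtMost t R) → k ≤ length (members (representatives R)) * t
    k≤#representatives*t {t} blocks≤t =
      subst (_≤ length (members (representatives R)) * t) (List.length-tabulate id)
        (pigeonhole _≟_ (rep R) (members (representatives R)) (allFin k)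
          (All.universal rep∈representatives (allFin k)) fibre≤t)
      where
      fibre≤t : ∀ y → length (fibre _≟_ (rep R) y (allFin k)) ≤ t
      fibre≤t y = ≤-trans
        (length-filterᵇ-mono
          (λ {x} rep-x≡y → ∼-sym (subst (Related R x) (toWitness rep-x≡y) (rep-related x))) (allFin k))
        (≤ᵇ⇒≤ _ t (every-allFin⇒∀ (λ i → length (block R i) ≤ᵇ t) blocks≤t y))

  rep-injective : ∀ {R R′} → IsEquivalence (Related R) → IsEquivalence (Related R′) →
                  (∀ i → rep R i ≡ rep R′ i) → R ≡ R′
  rep-injective {R} {R′} equiv equiv′ rep≗rep′ = lookup-ext λ i → lookup-ext λ j → T-ext
    (λ Rij  → R′.rep-≡⇒related (trans (sym (rep≗rep′ i)) (trans (R.rep-cong Rij) (rep≗rep′ j))))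
    (λ R′ij → R.rep-≡⇒related (trans (rep≗rep′ i) (trans (R′.rep-cong R′ij) (sym (rep≗rep′ j)))))
    where
    module R  = Representatives R equiv
    module R′ = Representatives R′ equiv′

  code-injective : ∀ {R R′} → IsEquivalence (Related R) → IsEquivalence (Related R′) →
                   code R ≡ code R′ → R ≡ R′
  code-injective {R} {R′} equiv equiv′ code≡code′ = rep-injective equiv equiv′ rep≗rep′
    where
    b : Vec Bool k
    b = representatives R
    b≡b′ : b ≡ representatives R′
    b≡b′ = cong proj₁ code≡code′
    isRep≗isRep′ : ∀ i → isRep R i ≡ isRep R′ i
    isRep≗isRep′ i = begin
      isRep R i                      ≡⟨ Vec.lookup∘tabulate (isRep R) i ⟨
      lookup b i                     ≡⟨ cong (λ c → lookup c i) b≡b′ ⟩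
      lookup (representatives R′) i  ≡⟨ Vec.lookup∘tabulate (isRep R′) i ⟩
      isRep R′ i                     ∎
      where open ≡-Reasoning
    others≡ : map (rep R) (nonMembers b) ≡ map (rep R′) (nonMembers b)
    others≡ = trans (cong proj₂ code≡code′) (cong (λ c → map (rep R′) (nonMembers c)) (sym b≡b′))
    rep≗rep′ : ∀ i → rep R i ≡ rep R′ i
    rep≗rep′ i with isRep R i in isRep≡
    ... | true  = trans (isRep⇒fixed {R} (subst T (sym isRep≡) tt))
                        (sym (isRep⇒fixed {R′} (subst T (trans (sym isRep≡) (isRep≗isRep′ i)) tt)))
    ... | false = map-≡⇒pointwise others≡
                    (∈-filter⁺ (T? ∘ not ∘ lookup b) (∈-allFin i)
                      (subst (T ∘ not) (trans (sym isRep≡) (sym (Vec.lookup∘tabulate (isRep R) i))) tt))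

  weight : Vec Bool k → ℕ
  weight b = length (members b) ^ length (nonMembers b)

  codes : List (Vec Bool k) → List (Vec Bool k × List (Fin k))
  codes = concatMap (λ b → map (b ,_) (words (length (nonMembers b)) (members b)))

  length-codes : ∀ bs → length (codes bs) ≡ sum (map weight bs)
  length-codes bs = trans (length-concatMap _ bs) (cong sum (List.map-cong length-codes-b bs))
    where
    length-codes-b : ∀ b → length (map (b ,_) (words (length (nonMembers b)) (members b))) ≡ weight b
    length-codes-b b = trans (List.length-map (b ,_) (words n (members b))) (length-words n (members b))
      where
      n : ℕ
      n = length (nonMembers b)

  Admissible : ℕ → Vec Bool k → Set
  Admissible t b = k ≤ length (members b) * t

  admissible? : ∀ t → Decidable (Admissible t)
  admissible? t b = k ≤? length (members b) * t

admissibles : ℕ → ∀ k → List (Vec Bool k)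
admissibles t k = filter (admissible? t) (vecs k bools)

code∈codes : ∀ {k} t (R : BRel k) → T (isEquivRel R) → T (blocksAtMost t R) →
             code R ∈ codes (admissibles t k)
code∈codes {k} t R equiv blocks≤t = ∈-concatMap⁺ (∈-map⁺ (b ,_) others∈words)
  (∈-filter⁺ (admissible? t) (∈-vecs (VecAll.universal bool∈bools b)) (k≤#representatives*t blocks≤t))
  where
  open Representatives R (isEquivRel⇒IsEquivalence R equiv)
  b : Vec Bool k
  b = representatives R
  others∈words : map (rep R) (nonMembers b) ∈ words (length (nonMembers b)) (members b)
  others∈words = subst (λ n → map (rep R) (nonMembers b) ∈ words n (members b))
    (List.length-map (rep R) (nonMembers b))
    (∈-words (All.map⁺ (All.universal rep∈representatives (nonMembers b))))

SP≤sum-weights : ∀ t k → SP t k ≤ sum (map weight (admissibles t k))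
SP≤sum-weights t k = begin
  length partitions                 ≤⟨ injection⇒length≤ code partitions-unique code∈ code-inj ⟩
  length (codes (admissibles t k))  ≡⟨ length-codes (admissibles t k) ⟩
  sum (map weight (admissibles t k)) ∎
  where
  open ≤-Reasoning
  isPartition : BRel k → Bool
  isPartition R = isEquivRel R ∧ blocksAtMost t R
  partitions : List (BRel k)
  partitions = filterᵇ isPartition (vecs k (vecs k bools))
  partitions-unique : Unique partitions
  partitions-unique = Unique.filter⁺ (T? ∘ isPartition) (vecs-unique k (vecs-unique k bools-unique))
  partition-properties : ∀ {R} → R ∈ partitions → T (isEquivRel R) × T (blocksAtMost t R)
  partition-properties {R} R∈ =
    Equivalence.to (T-∧ {isEquivRel R})
      (proj₂ (∈-filter⁻ (T? ∘ isPartition) {xs = vecs k (vecs k bools)} R∈))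
  code∈ : ∀ {R} → R ∈ partitions → code R ∈ codes (admissibles t k)
  code∈ {R} R∈ = let equiv , blocks≤t = partition-properties R∈ in code∈codes t R equiv blocks≤t
  code-inj : ∀ {R R′} → R ∈ partitions → R′ ∈ partitions → code R ≡ code R′ → R ≡ R′
  code-inj {R} {R′} R∈ R′∈ =
    code-injective (isEquivRel⇒IsEquivalence R  (proj₁ (partition-properties R∈)))
                   (isEquivRel⇒IsEquivalence R′ (proj₁ (partition-properties R′∈)))

SP^t*t^kt≤k^[k[t∸1]]*2^[3kt] : ∀ k t .{{_ : NonZero t}} → ExpLe t k →
                               SP t k ^ t * t ^ (k * t) ≤ k ^ (k * (t ∸ 1)) * 2 ^ (3 * k * t)
SP^t*t^kt≤k^[k[t∸1]]*2^[3kt] k t e^t≤k = begin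
  SP t k ^ t * t ^ (k * t)           ≤⟨ *-monoˡ-≤ (t ^ (k * t)) (^-monoˡ-≤ t (SP≤sum-weights t k)) ⟩
  sum ws ^ t * t ^ (k * t)           ≤⟨ [sum]^t*y≤[length]^t*z t ws (All.map⁺ (All.tabulate weight-bound)) ⟩
  length ws ^ t * (K * (4 ^ k) ^ t)  ≤⟨ *-monoˡ-≤ (K * (4 ^ k) ^ t) (^-monoˡ-≤ t #admissibles≤2^k) ⟩
  (2 ^ k) ^ t * (K * (4 ^ k) ^ t)    ≡⟨ x∙yz≈y∙xz *-commutativeSemigroup ((2 ^ k) ^ t) K ((4 ^ k) ^ t) ⟩
  K * ((2 ^ k) ^ t * (4 ^ k) ^ t)    ≡⟨ cong (K *_) ([2^k]^t*[4^k]^t≡2^[3kt] k t) ⟩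
  K * 2 ^ (3 * k * t)                ∎
  where
  open ≤-Reasoning
  K : ℕ
  K = k ^ (k * (t ∸ 1))
  ws : List ℕ
  ws = map weight (admissibles t k)
  #admissibles≤2^k : length ws ≤ 2 ^ k
  #admissibles≤2^k = begin
    length ws                 ≡⟨ List.length-map weight (admissibles t k) ⟩
    length (admissibles t k)  ≤⟨ List.length-filter (admissible? t) (vecs k bools) ⟩
    length (vecs k bools)     ≡⟨ length-vecs k bools ⟩
    2 ^ k                     ∎
  weight-bound : ∀ {b} → b ∈ admissibles t k → weight b ^ t * t ^ (k * t) ≤ K * (4 ^ k) ^ t
  weight-bound {b} b∈ =
    [m^n]^t*t^kt≤k^[k[t∸1]]*[4^k]^t {k} {length (members b)} {length (nonMembers b)} e^t≤k
      (length-members+length-nonMembers b) (proj₂ (∈-filter⁻ (admissible? t) {xs = vecs k bools} b∈))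

proposition2p6 : ∃[ k₀ ] (∀ (k t : ℕ) → k₀ ≤ k → 1 ≤ t → ExpLe t k →
    LeMulExp (SP t k ^ t * t ^ (k * t)) (k ^ (k * (t ∸ 1))) (3 * k * t))
proposition2p6 = 0 , λ k t _ 1≤t e^t≤k →
  N≤M*2^a⇒LeMulExp (k ^ (k * (t ∸ 1))) (3 * k * t)
    (SP^t*t^kt≤k^[k[t∸1]]*2^[3kt] k t {{>-nonZero 1≤t}} e^t≤k)
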